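{- The only integer triples $(2,6,c)$ with $c\ge3$, $c\ne6$, such that each of $(2,6,c)$, $(3,7,c+1)$ and $(4,8,c+2)$ is multiplicatively dependent, are $(2,6,8)$ and $(2,6,48)$.
   Context: A tuple $(z_1,\dots,z_n)$ of positive integers is multiplicatively dependent if there exists a nonzero $(k_1,\dots,k_n)\in\mathbb{Z}^n$ with $z_1^{k_1}\cdots z_n^{k_n}=1$. -}

module Defs where

open import Data.Nat using (ℕ; zero; suc) renaming (_^_ to _^ℕ_)
open import Data.Integer using (ℤ; +_; -[1+_])
open import Data.Rational using (ℚ; _/_; _*_; 0ℚ; 1ℚ)
import Data.Rational as ℚ
open import Data.Fin using (Fin)
open import Data.Nat.Properties using (m^n≢0)
open import Data.Vec using (Vec; lookup; foldr; zipWith)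
open import Data.Product using (∃; _×_)
open import Relation.Binary.PropositionalEquality using (_≡_)
open import Relation.Nullary using (¬_)

-- z ^ k in ℚ for a positive integer z (given as a natural) and k ∈ ℤ.
-- (The value for z = 0 is irrelevant: only applied to positive integers.)
zpow : ℕ → ℤ → ℚ
zpow z (+ k) = (+ (z ^ℕ k)) / 1
zpow zero -[1+ k ] = 0ℚ
zpow (suc m) -[1+ k ] = _/_ (+ 1) (suc m ^ℕ suc k) {{m^n≢0 (suc m) (suc k)}}

prodPow : ∀ {n} → Vec ℕ n → Vec ℤ n → ℚ
prodPow zs ks = foldr _ _*_ 1ℚ (zipWith zpow zs ks)

MultDep : ∀ {n} → Vec ℕ n → Set
MultDep {n} zs = ∃ λ (ks : Vec ℤ n) → ¬ (∀ (i : Fin n) → lookup ks i ≡ + 0) × prodPow zs ks ≡ 1ℚ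

-- If z₁^k₁ · z₂^k₂ · z₃^k₃ = 1 and (z₁, z₂) is multiplicatively independent, then k₃ ≠ 0,
-- and clearing denominators shows that every prime factor of z₃ divides z₁ or z₂.  Hence
-- c = 2^u 3^v and c + 1 = 3^s 7^t.  As c and c + 1 are coprime, either v = 0, where
-- 7 ∤ 2^u + 1 leaves 2^u + 1 = 3^s, or s = 0, leaving 2^u 3^v + 1 = 7^t.  Congruences bound
-- the exponents: if c + 1 = 3^s then 16 ∣ c forces 5 ∣ c, and if c + 1 = 7^t then 32 ∣ c
-- forces 5 ∣ c and 9 ∣ c forces 19 ∣ c.  Of the few values left only 8 and 48 survive,
-- and 2³ = 8, 3² = 9, 4³ = 8², 2³ · 6 = 48, 7² = 49 show that both are solutions.

module Submission where

open import Defs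
open import Data.Empty using (⊥-elim)
open import Data.Fin using (zero; suc)
open import Data.Integer using (ℤ; +_; -[1+_]; +[1+_]; -1ℤ)
import Data.Integer.Properties as ℤ
open import Data.List using (List)
open import Data.List.Relation.Unary.All as List using ([]; _∷_)
open import Data.Nat using (ℕ; zero; suc; _+_; _*_; _^_; _%_; _/_; _≤_; _≤?_; NonZero)
open import Data.Nat.Divisibility
open import Data.Nat.DivMod
open import Data.Nat.ListAction using (product)
open import Data.Nat.ListAction.Properties using (∈⇒∣product)
open import Data.Nat.Primality
open import Data.Nat.Primality.Factorisation using (PrimeFactorisation; factorise)
open import Data.Nat.Properties
open import Algebra.Properties.CommutativeSemigroup *-commutativeSemigroup using (x∙yz≈y∙xz)
open import Data.Nat.Tactic.RingSolver using (solve-∀)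
open import Data.Product using (_×_; _,_; ∃₂; map₂)
open import Data.Rational as ℚ using (1ℚ; toℚᵘ)
open import Data.Rational.Properties using (toℚᵘ-fromℚᵘ; toℚᵘ-homo-*; toℚᵘ-cong)
open import Data.Rational.Unnormalised using (*≡*; _≃_; 1ℚᵘ) renaming (_/_ to _/ᵘ_; _*_ to _*ᵘ_)
open import Data.Rational.Unnormalised.Properties
  using (≃-refl; ≃-sym; ≃-trans; *-cong; module ≃-Reasoning)
open import Data.Sum as Sum using (_⊎_; inj₁; inj₂; [_,_]′)
open import Data.Vec using (Vec; []; _∷_; lookup)
open import Data.Vec.Relation.Unary.All using (All; []; _∷_)
open import Function using (_∘_; case_of_; it)
open import Function.Bundles using (_⇔_; mk⇔)
open import Relation.Binary.PropositionalEquality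
open import Relation.Nullary using (¬_; contradiction)
open import Relation.Nullary.Decidable using (True; toWitness; from-yes; from-no; _→-dec_)

infix 10 _⁺ _⁻

_⁺ : ℤ → ℕ
(+ n) ⁺ = n
-[1+ n ] ⁺ = 0

_⁻ : ℤ → ℕ
(+ n) ⁻ = 0
-[1+ n ] ⁻ = suc n

prodPow⁺ prodPow⁻ : ∀ {n} → Vec ℕ n → Vec ℤ n → ℕ
prodPow⁺ [] [] = 1
prodPow⁺ (z ∷ zs) (k ∷ ks) = z ^ k ⁺ * prodPow⁺ zs ks
prodPow⁻ [] [] = 1
prodPow⁻ (z ∷ zs) (k ∷ ks) = z ^ k ⁻ * prodPow⁻ zs ks

prodPow⁻-nonZero : ∀ {n} {zs : Vec ℕ n} → All NonZero zs → ∀ ks → NonZero (prodPow⁻ zs ks)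
prodPow⁻-nonZero [] [] = _
prodPow⁻-nonZero {zs = z ∷ zs} (nz ∷ nzs) (k ∷ ks) =
  m*n≢0 _ _ {{m^n≢0 z (k ⁻) {{nz}}}} {{prodPow⁻-nonZero nzs ks}}

toℚᵘ-/ : ∀ i n .{{_ : NonZero n}} → toℚᵘ (i ℚ./ n) ≃ i /ᵘ n
toℚᵘ-/ i (suc n) = toℚᵘ-fromℚᵘ (i /ᵘ suc n)

toℚᵘ-zpow : ∀ z .{{_ : NonZero z}} k →
            toℚᵘ (zpow z k) ≃ _/ᵘ_ (+ z ^ k ⁺) (z ^ k ⁻) {{m^n≢0 z (k ⁻)}}
toℚᵘ-zpow z (+ n) = toℚᵘ-/ (+ z ^ n) 1
toℚᵘ-zpow (suc m) -[1+ n ] = toℚᵘ-/ (+ 1) (suc m ^ suc n) {{m^n≢0 (suc m) (suc n)}}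

+/ᵘ-* : ∀ m n o p .{{_ : NonZero n}} .{{_ : NonZero p}} →
        (+ m /ᵘ n) *ᵘ (+ o /ᵘ p) ≡ _/ᵘ_ (+ (m * o)) (n * p) {{m*n≢0 n p}}
+/ᵘ-* m (suc n) o (suc p) = cong (_/ᵘ (suc n * suc p)) (sym (ℤ.pos-* m o))

toℚᵘ-prodPow : ∀ {n} {zs : Vec ℕ n} (nz : All NonZero zs) ks →
  toℚᵘ (prodPow zs ks) ≃ _/ᵘ_ (+ prodPow⁺ zs ks) (prodPow⁻ zs ks) {{prodPow⁻-nonZero nz ks}}
toℚᵘ-prodPow [] [] = ≃-refl
toℚᵘ-prodPow {zs = z ∷ zs} (nz ∷ nzs) (k ∷ ks) = begin
  toℚᵘ (zpow z k ℚ.* prodPow zs ks)        ≈⟨ toℚᵘ-homo-* (zpow z k) (prodPow zs ks) ⟩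
  toℚᵘ (zpow z k) *ᵘ toℚᵘ (prodPow zs ks)  ≈⟨ *-cong (toℚᵘ-zpow z k) (toℚᵘ-prodPow nzs ks) ⟩
  (+ z ^ k ⁺ /ᵘ z ^ k ⁻) *ᵘ (+ N /ᵘ D)     ≡⟨ +/ᵘ-* (z ^ k ⁺) (z ^ k ⁻) N D ⟩
  + (z ^ k ⁺ * N) /ᵘ (z ^ k ⁻ * D)         ∎
  where
  open ≃-Reasoning
  N D : ℕ
  N = prodPow⁺ zs ks
  D = prodPow⁻ zs ks
  instance
    _ = nz
    _ = m^n≢0 z (k ⁻)
    _ = prodPow⁻-nonZero nzs ks
    _ = prodPow⁻-nonZero (nz ∷ nzs) (k ∷ ks)

+m/ᵘn≃1⇒m≡n : ∀ m n .{{_ : NonZero n}} → + m /ᵘ n ≃ 1ℚᵘ → m ≡ n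
+m/ᵘn≃1⇒m≡n m (suc n) (*≡* eq) =
  ℤ.+-injective (trans (sym (ℤ.*-identityʳ (+ m))) (trans eq (ℤ.*-identityˡ (+ suc n))))

prodPow≡1⇒prodPow⁺≡prodPow⁻ : ∀ {n} {zs : Vec ℕ n} → All NonZero zs → ∀ ks →
  prodPow zs ks ≡ 1ℚ → prodPow⁺ zs ks ≡ prodPow⁻ zs ks
prodPow≡1⇒prodPow⁺≡prodPow⁻ nz ks eq = +m/ᵘn≃1⇒m≡n _ _ {{prodPow⁻-nonZero nz ks}}
  (≃-trans (≃-sym (toℚᵘ-prodPow nz ks)) (toℚᵘ-cong eq))

prime∣^⇒∣ : ∀ {p m} n → Prime p → p ∣ m ^ n → p ∣ m
prime∣^⇒∣ zero    pp p∣1 = contradiction (∣1⇒≡1 p∣1) (λ { refl → ¬prime[1] pp })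
prime∣^⇒∣ {m = m} (suc n) pp p∣m^[1+n] with euclidsLemma m (m ^ n) pp p∣m^[1+n]
... | inj₁ p∣m = p∣m
... | inj₂ p∣m^n = prime∣^⇒∣ n pp p∣m^n

prime∣^*^⇒∣⊎∣ : ∀ {p m n} i j → Prime p → p ∣ m ^ i * n ^ j → p ∣ m ⊎ p ∣ n
prime∣^*^⇒∣⊎∣ {m = m} {n} i j pp p∣ with euclidsLemma (m ^ i) (n ^ j) pp p∣
... | inj₁ p∣m^i = inj₁ (prime∣^⇒∣ i pp p∣m^i)
... | inj₂ p∣n^j = inj₂ (prime∣^⇒∣ j pp p∣n^j)

prime∤^ : ∀ {p m} n → Prime p → ¬ p ∣ m → ¬ p ∣ m ^ n
prime∤^ n pp p∤m = p∤m ∘ prime∣^⇒∣ n pp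

prime∤^*^ : ∀ {p m n} i j → Prime p → ¬ p ∣ m → ¬ p ∣ n → ¬ p ∣ m ^ i * n ^ j
prime∤^*^ i j pp p∤m p∤n = [ p∤m , p∤n ]′ ∘ prime∣^*^⇒∣⊎∣ i j pp

prime∣prime⇒≡ : ∀ {p q} → Prime p → Prime q → p ∣ q → p ≡ q
prime∣prime⇒≡ pp pq p∣q with prime⇒irreducible pq p∣q
... | inj₁ refl = contradiction pp ¬prime[1]
... | inj₂ p≡q  = p≡q

prime[3] : Prime 3
prime[3] = from-yes (prime? 3)

prime[5] : Prime 5
prime[5] = from-yes (prime? 5)

prime[7] : Prime 7
prime[7] = from-yes (prime? 7)

module _ {a b q} {{_ : NonZero a}} {{_ : NonZero b}}
         (a≢1 : a ≢ 1) (pq : Prime q) (q∣b : q ∣ b) (q∤a : ¬ q ∣ a) where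

  private
    q∤a^i*1 : ∀ i → ¬ q ∣ a ^ i * 1
    q∤a^i*1 i q∣ = q∤a (prime∣^⇒∣ i pq (subst (q ∣_) (*-identityʳ (a ^ i)) q∣))

    q∣a^i*b^[1+n]*1 : ∀ i n → q ∣ a ^ i * (b ^ suc n * 1)
    q∣a^i*b^[1+n]*1 i n = ∣n⇒∣m*n (a ^ i) (∣m⇒∣m*n 1 (∣m⇒∣m*n (b ^ n) q∣b))

    a^[1+n]*1≢1 : ∀ n → a ^ suc n * 1 ≢ 1
    a^[1+n]*1≢1 n eq with m^n≡1⇒n≡0∨m≡1 a (suc n) (trans (sym (*-identityʳ _)) eq)
    ... | inj₂ a≡1 = a≢1 a≡1

    balanced : ∀ ks → prodPow (a ∷ b ∷ []) ks ≡ 1ℚ →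
               prodPow⁺ (a ∷ b ∷ []) ks ≡ prodPow⁻ (a ∷ b ∷ []) ks
    balanced = prodPow≡1⇒prodPow⁺≡prodPow⁻ (it ∷ it ∷ [])

  ¬MultDep-pair : ¬ MultDep (a ∷ b ∷ [])
  ¬MultDep-pair (ks@(k₁ ∷ +[1+ n ] ∷ []) , _ , eq) =
    q∤a^i*1 (k₁ ⁻) (subst (q ∣_) (balanced ks eq) (q∣a^i*b^[1+n]*1 (k₁ ⁺) n))
  ¬MultDep-pair (ks@(k₁ ∷ -[1+ n ] ∷ []) , _ , eq) =
    q∤a^i*1 (k₁ ⁺) (subst (q ∣_) (sym (balanced ks eq)) (q∣a^i*b^[1+n]*1 (k₁ ⁻) n))
  ¬MultDep-pair (ks@(+[1+ n ] ∷ + 0 ∷ []) , _ , eq) = a^[1+n]*1≢1 n (balanced ks eq)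
  ¬MultDep-pair (ks@(-[1+ n ] ∷ + 0 ∷ []) , _ , eq) = a^[1+n]*1≢1 n (sym (balanced ks eq))
  ¬MultDep-pair ((+ 0 ∷ + 0 ∷ []) , k≢0 , _) = k≢0 λ { zero → refl ; (suc zero) → refl }

module _ {a b z} {{_ : NonZero a}} {{_ : NonZero b}} {{_ : NonZero z}} where

  private
    balanced : ∀ ks → prodPow (a ∷ b ∷ z ∷ []) ks ≡ 1ℚ →
               prodPow⁺ (a ∷ b ∷ z ∷ []) ks ≡ prodPow⁻ (a ∷ b ∷ z ∷ []) ks
    balanced = prodPow≡1⇒prodPow⁺≡prodPow⁻ (it ∷ it ∷ it ∷ [])

    ∣a^i*[b^j*[z^[1+n]*1]] : ∀ {p} i j n → p ∣ z → p ∣ a ^ i * (b ^ j * (z ^ suc n * 1))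
    ∣a^i*[b^j*[z^[1+n]*1]] i j n p∣z =
      ∣n⇒∣m*n (a ^ i) (∣n⇒∣m*n (b ^ j) (∣m⇒∣m*n 1 (∣m⇒∣m*n (z ^ n) p∣z)))

    prime∣a^i*[b^j*1] : ∀ {p} i j → Prime p → p ∣ a ^ i * (b ^ j * 1) → p ∣ a ⊎ p ∣ b
    prime∣a^i*[b^j*1] {p} i j pp =
      prime∣^*^⇒∣⊎∣ i j pp ∘ subst (p ∣_) (cong (a ^ i *_) (*-identityʳ (b ^ j)))

  MultDep-triple⇒prime∣ : ¬ MultDep (a ∷ b ∷ []) → MultDep (a ∷ b ∷ z ∷ []) →
                          ∀ {p} → Prime p → p ∣ z → p ∣ a ⊎ p ∣ b
  MultDep-triple⇒prime∣ indep ((k₁ ∷ k₂ ∷ + 0 ∷ []) , k≢0 , eq) _ _ = contradiction dep indep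
    where
    dep : MultDep (a ∷ b ∷ [])
    dep = (k₁ ∷ k₂ ∷ []) , (λ k≡0 → k≢0 (extend k≡0)) , eq
      where
      extend : ∀ {k₁ k₂} → (∀ i → lookup (k₁ ∷ k₂ ∷ []) i ≡ + 0) →
               ∀ i → lookup (k₁ ∷ k₂ ∷ + 0 ∷ []) i ≡ + 0
      extend k≡0 zero             = k≡0 zero
      extend k≡0 (suc zero)       = k≡0 (suc zero)
      extend k≡0 (suc (suc zero)) = refl
  MultDep-triple⇒prime∣ _ (ks@(k₁ ∷ k₂ ∷ +[1+ n ] ∷ []) , _ , eq) {p} pp p∣z =
    prime∣a^i*[b^j*1] (k₁ ⁻) (k₂ ⁻) pp
      (subst (p ∣_) (balanced ks eq) (∣a^i*[b^j*[z^[1+n]*1]] (k₁ ⁺) (k₂ ⁺) n p∣z))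
  MultDep-triple⇒prime∣ _ (ks@(k₁ ∷ k₂ ∷ -[1+ n ] ∷ []) , _ , eq) {p} pp p∣z =
    prime∣a^i*[b^j*1] (k₁ ⁺) (k₂ ⁺) pp
      (subst (p ∣_) (sym (balanced ks eq)) (∣a^i*[b^j*[z^[1+n]*1]] (k₁ ⁻) (k₂ ⁻) n p∣z))

product≡^*^ : ∀ {x y} {ps : List ℕ} → List.All (λ p → p ≡ x ⊎ p ≡ y) ps →
              ∃₂ λ i j → product ps ≡ x ^ i * y ^ j
product≡^*^ [] = 0 , 0 , refl
product≡^*^ {x} {y} (inj₁ refl ∷ ps) with product≡^*^ ps
... | i , j , eq = suc i , j , trans (cong (x *_) eq) (sym (*-assoc x (x ^ i) (y ^ j)))
product≡^*^ {x} {y} (inj₂ refl ∷ ps) with product≡^*^ ps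
... | i , j , eq = i , suc j , trans (cong (y *_) eq) (x∙yz≈y∙xz y (x ^ i) (y ^ j))

smooth-factorisation : ∀ {x y} n .{{_ : NonZero n}} → (∀ {p} → Prime p → p ∣ n → p ≡ x ⊎ p ≡ y) →
                       ∃₂ λ i j → n ≡ x ^ i * y ^ j
smooth-factorisation {x} {y} n x-or-y =
  map₂ (map₂ (trans isFactorisation)) (product≡^*^ factors-x-or-y)
  where
  open PrimeFactorisation (factorise n)
  factors-x-or-y : List.All (λ p → p ≡ x ⊎ p ≡ y) factors
  factors-x-or-y = List.tabulate λ {p} p∈factors →
    x-or-y (List.lookup factorsPrime p∈factors)
           (subst (p ∣_) (sym isFactorisation) (∈⇒∣product p∈factors))

^-%-1 : ∀ x n m .{{_ : NonZero m}} → x % m ≡ 1 % m → x ^ n % m ≡ 1 % m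
^-%-1 x zero    m _      = refl
^-%-1 x (suc n) m x≡1 = begin
  x * x ^ n % m              ≡⟨ %-distribˡ-* x (x ^ n) m ⟩
  (x % m) * (x ^ n % m) % m  ≡⟨ cong₂ (λ u v → u * v % m) x≡1 (^-%-1 x n m x≡1) ⟩
  (1 % m) * (1 % m) % m      ≡⟨ %-distribˡ-* 1 1 m ⟨
  1 % m                      ∎
  where open ≡-Reasoning

^-%-periodic : ∀ a k m .{{_ : NonZero k}} .{{_ : NonZero m}} →
               a ^ k % m ≡ 1 % m → ∀ n → a ^ n % m ≡ a ^ (n % k) % m
^-%-periodic a k m a^k≡1 n = begin
  a ^ n % m                          ≡⟨ cong (λ e → a ^ e % m) (m≡m%n+[m/n]*n n k) ⟩
  a ^ (r + q * k) % m                ≡⟨ cong (_% m) (^-distribˡ-+-* a r (q * k)) ⟩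
  a ^ r * a ^ (q * k) % m            ≡⟨ %-distribˡ-* (a ^ r) (a ^ (q * k)) m ⟩
  (a ^ r % m) * (a ^ (q * k) % m) % m ≡⟨ cong (λ x → (a ^ r % m) * x % m) a^qk≡1 ⟩
  (a ^ r % m) * (1 % m) % m          ≡⟨ %-distribˡ-* (a ^ r) 1 m ⟨
  a ^ r * 1 % m                      ≡⟨ cong (_% m) (*-identityʳ (a ^ r)) ⟩
  a ^ r % m                          ∎
  where
  open ≡-Reasoning
  r q : ℕ
  r = n % k
  q = n / k
  a^qk≡1 : a ^ (q * k) % m ≡ 1 % m
  a^qk≡1 = begin
    a ^ (q * k) % m   ≡⟨ cong (λ e → a ^ e % m) (*-comm q k) ⟩
    a ^ (k * q) % m   ≡⟨ cong (_% m) (^-*-assoc a k q) ⟨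
    (a ^ k) ^ q % m   ≡⟨ ^-%-1 (a ^ k) q m a^k≡1 ⟩
    1 % m             ∎

[m+1]%n≡1%n⇒n∣m : ∀ m n .{{_ : NonZero n}} → (m + 1) % n ≡ 1 % n → n ∣ m
[m+1]%n≡1%n⇒n∣m m 1 _ = 1∣ m
[m+1]%n≡1%n⇒n∣m m n@(suc (suc _)) eq = divides q (+-cancelʳ-≡ 1 m (q * n) (begin
  m + 1                    ≡⟨ m≡m%n+[m/n]*n (m + 1) n ⟩
  (m + 1) % n + q * n      ≡⟨ cong (_+ q * n) eq ⟩
  1 + q * n                ≡⟨ +-comm 1 (q * n) ⟩
  q * n + 1                ∎))
  where
  open ≡-Reasoning
  q : ℕ
  q = (m + 1) / n

-- With c + 1 = a ^ t, the divisibilities M ∣ c and m ∣ c say a ^ t ≡ 1 modulo M and m; both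
-- conditions are periodic in t with period k, so comparing them for t < k suffices.
∣-transfer : ∀ a k M m .{{_ : NonZero k}} .{{_ : NonZero M}} .{{_ : NonZero m}} →
  a ^ k % M ≡ 1 % M → a ^ k % m ≡ 1 % m →
  True (allUpTo? (λ r → (a ^ r % M ≟ 1 % M) →-dec (a ^ r % m ≟ 1 % m)) k) →
  ∀ {c} t → c + 1 ≡ a ^ t → M ∣ c → m ∣ c
∣-transfer a k M m a^k≡1[M] a^k≡1[m] residues {c} t c+1≡a^t M∣c =
  [m+1]%n≡1%n⇒n∣m c m (begin
  (c + 1) % m      ≡⟨ cong (_% m) c+1≡a^t ⟩
  a ^ t % m        ≡⟨ ^-%-periodic a k m a^k≡1[m] t ⟩
  a ^ (t % k) % m  ≡⟨ toWitness residues (m%n<n t k) a^[t%k]≡1[M] ⟩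
  1 % m            ∎)
  where
  open ≡-Reasoning
  a^[t%k]≡1[M] : a ^ (t % k) % M ≡ 1 % M
  a^[t%k]≡1[M] = begin
    a ^ (t % k) % M  ≡⟨ ^-%-periodic a k M a^k≡1[M] t ⟨
    a ^ t % M        ≡⟨ cong (_% M) c+1≡a^t ⟨
    (c + 1) % M      ≡⟨ %-remove-+ˡ 1 M∣c ⟩
    1 % M            ∎

m^k∣m^[k+n] : ∀ m k n → m ^ k ∣ m ^ (k + n)
m^k∣m^[k+n] m k n = divides (m ^ n) (trans (^-distribˡ-+-* m k n) (*-comm (m ^ k) (m ^ n)))

7∤2^u+1 : ∀ u → ¬ 7 ∣ 2 ^ u + 1
7∤2^u+1 0 = from-no (7 ∣? 2)
7∤2^u+1 1 = from-no (7 ∣? 3)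
7∤2^u+1 2 = from-no (7 ∣? 5)
7∤2^u+1 (suc (suc (suc u))) 7∣2^[3+u]+1 =
  7∤2^u+1 u (∣m+n∣m⇒∣n (subst (7 ∣_) (8x+1≡7x+[x+1] (2 ^ u)) 7∣2^[3+u]+1) (m∣m*n (2 ^ u)))
  where
  8x+1≡7x+[x+1] : ∀ x → 2 * (2 * (2 * x)) + 1 ≡ 7 * x + (x + 1)
  8x+1≡7x+[x+1] = solve-∀

2^u+1≡3^s⇒u≡1⊎u≡3 : ∀ u s → 2 ^ u + 1 ≡ 3 ^ s → u ≡ 1 ⊎ u ≡ 3
2^u+1≡3^s⇒u≡1⊎u≡3 0 s eq = ⊥-elim (prime∤^ s prime[2] (from-no (2 ∣? 3)) (subst (2 ∣_) eq ∣-refl))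
2^u+1≡3^s⇒u≡1⊎u≡3 1 s eq = inj₁ refl
2^u+1≡3^s⇒u≡1⊎u≡3 2 s eq = ⊥-elim (prime∤^ s prime[5] (from-no (5 ∣? 3)) (subst (5 ∣_) eq ∣-refl))
2^u+1≡3^s⇒u≡1⊎u≡3 3 s eq = inj₂ refl
2^u+1≡3^s⇒u≡1⊎u≡3 u@(suc (suc (suc (suc u′)))) s eq =
  ⊥-elim (prime∤^ u prime[5] (from-no (5 ∣? 2))
    (∣-transfer 3 4 16 5 refl refl _ s eq (m^k∣m^[k+n] 2 4 u′)))

2^u*3^[1+v]+1≡7^t⇒ : ∀ u v t → 2 ^ u * 3 ^ suc v + 1 ≡ 7 ^ t → (u ≡ 1 ⊎ u ≡ 4) × v ≡ 0
2^u*3^[1+v]+1≡7^t⇒ 0 v t eq =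
  ⊥-elim (prime∤^ (suc v) prime[2] (from-no (2 ∣? 3)) (subst (2 ∣_) (*-identityˡ (3 ^ suc v)) 2∣c))
  where
  2∣c : 2 ∣ 1 * 3 ^ suc v
  2∣c = [m+1]%n≡1%n⇒n∣m _ 2 (trans (cong (_% 2) eq) (^-%-1 7 t 2 refl))
2^u*3^[1+v]+1≡7^t⇒ u@(suc _) (suc v) t eq =
  ⊥-elim (prime∤^*^ u (suc (suc v)) (from-yes (prime? 19)) (from-no (19 ∣? 2)) (from-no (19 ∣? 3))
    (∣-transfer 7 3 9 19 refl refl _ t eq (∣n⇒∣m*n (2 ^ u) (m^k∣m^[k+n] 3 2 v))))
2^u*3^[1+v]+1≡7^t⇒ 1 0 t eq = inj₁ refl , refl
2^u*3^[1+v]+1≡7^t⇒ 2 0 t eq =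
  ⊥-elim (prime∤^ t (from-yes (prime? 13)) (from-no (13 ∣? 7)) (subst (13 ∣_) eq ∣-refl))
2^u*3^[1+v]+1≡7^t⇒ 3 0 t eq =
  ⊥-elim (prime∤^ t prime[5] (from-no (5 ∣? 7)) (subst (5 ∣_) eq (divides 5 refl)))
2^u*3^[1+v]+1≡7^t⇒ 4 0 t eq = inj₂ refl , refl
2^u*3^[1+v]+1≡7^t⇒ u@(suc (suc (suc (suc (suc u′))))) 0 t eq =
  ⊥-elim (prime∤^*^ u 1 prime[5] (from-no (5 ∣? 2)) (from-no (5 ∣? 3))
    (∣-transfer 7 4 32 5 refl refl _ t eq (∣m⇒∣m*n (3 ^ 1) (m^k∣m^[k+n] 2 5 u′))))

smooth-consecutive : ∀ {c} u v s t → c ≡ 2 ^ u * 3 ^ v → c + 1 ≡ 3 ^ s * 7 ^ t →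
                     3 ≤ c → c ≢ 6 → c ≡ 8 ⊎ c ≡ 48
smooth-consecutive u (suc v) (suc s) t refl eq _ _ = ⊥-elim (from-no (3 ∣? 1) (∣m+n∣m⇒∣n 3∣c+1 3∣c))
  where
  3∣c : 3 ∣ 2 ^ u * 3 ^ suc v
  3∣c = ∣n⇒∣m*n (2 ^ u) (m∣m*n (3 ^ v))
  3∣c+1 : 3 ∣ 2 ^ u * 3 ^ suc v + 1
  3∣c+1 = subst (3 ∣_) (sym eq) (∣m⇒∣m*n (7 ^ t) (m∣m*n (3 ^ s)))
smooth-consecutive u 0 s (suc t) refl eq _ _ =
  ⊥-elim (7∤2^u+1 u (subst (λ x → 7 ∣ x + 1) (*-identityʳ (2 ^ u)) 7∣c+1))
  where
  7∣c+1 : 7 ∣ 2 ^ u * 1 + 1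
  7∣c+1 = subst (7 ∣_) (sym eq) (∣n⇒∣m*n (3 ^ s) (m∣m*n (7 ^ t)))
smooth-consecutive u 0 s 0 refl eq 3≤c _
  with 2^u+1≡3^s⇒u≡1⊎u≡3 u s
         (subst₂ (λ x y → x + 1 ≡ y) (*-identityʳ (2 ^ u)) (*-identityʳ (3 ^ s)) eq)
... | inj₁ refl = contradiction 3≤c (from-no (3 ≤? 2))
... | inj₂ refl = inj₁ refl
smooth-consecutive u (suc v) 0 t refl eq _ c≢6
  with 2^u*3^[1+v]+1≡7^t⇒ u v t (trans eq (*-identityˡ (7 ^ t)))
... | inj₁ refl , refl = contradiction refl c≢6
... | inj₂ refl , refl = inj₂ refl

MultDep[2,6,c]⇒primes : ∀ {c} {{_ : NonZero c}} → MultDep (2 ∷ 6 ∷ c ∷ []) →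
                        ∀ {p} → Prime p → p ∣ c → p ≡ 2 ⊎ p ≡ 3
MultDep[2,6,c]⇒primes dep pp p∣c with MultDep-triple⇒prime∣ [2,6]-indep dep pp p∣c
  where
  [2,6]-indep : ¬ MultDep (2 ∷ 6 ∷ [])
  [2,6]-indep = ¬MultDep-pair (λ ()) prime[3] (divides 2 refl) (from-no (3 ∣? 2))
... | inj₁ p∣2 = inj₁ (prime∣prime⇒≡ pp prime[2] p∣2)
... | inj₂ p∣6 = Sum.map (prime∣prime⇒≡ pp prime[2]) (prime∣prime⇒≡ pp prime[3])
                         (euclidsLemma 2 3 pp p∣6)

MultDep[3,7,c]⇒primes : ∀ {c} {{_ : NonZero c}} → MultDep (3 ∷ 7 ∷ c ∷ []) →
                        ∀ {p} → Prime p → p ∣ c → p ≡ 3 ⊎ p ≡ 7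
MultDep[3,7,c]⇒primes dep pp p∣c =
  Sum.map (prime∣prime⇒≡ pp prime[3]) (prime∣prime⇒≡ pp prime[7])
          (MultDep-triple⇒prime∣ [3,7]-indep dep pp p∣c)
  where
  [3,7]-indep : ¬ MultDep (3 ∷ 7 ∷ [])
  [3,7]-indep = ¬MultDep-pair (λ ()) prime[7] ∣-refl (from-no (7 ∣? 3))

MultDep-8 : MultDep (2 ∷ 6 ∷ 8 ∷ []) × MultDep (3 ∷ 7 ∷ 9 ∷ []) × MultDep (4 ∷ 8 ∷ 10 ∷ [])
MultDep-8 = ((+ 3 ∷ + 0 ∷ -1ℤ ∷ [])       , (λ k≡0 → case k≡0 zero of λ ()) , refl)
          , ((+ 2 ∷ + 0 ∷ -1ℤ ∷ [])       , (λ k≡0 → case k≡0 zero of λ ()) , refl)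
          , ((+ 3 ∷ -[1+ 1 ] ∷ + 0 ∷ [])  , (λ k≡0 → case k≡0 zero of λ ()) , refl)

MultDep-48 : MultDep (2 ∷ 6 ∷ 48 ∷ []) × MultDep (3 ∷ 7 ∷ 49 ∷ []) × MultDep (4 ∷ 8 ∷ 50 ∷ [])
MultDep-48 = ((+ 3 ∷ + 1 ∷ -1ℤ ∷ [])      , (λ k≡0 → case k≡0 zero of λ ()) , refl)
           , ((+ 0 ∷ + 2 ∷ -1ℤ ∷ [])      , (λ k≡0 → case k≡0 (suc zero) of λ ()) , refl)
           , ((+ 3 ∷ -[1+ 1 ] ∷ + 0 ∷ []) , (λ k≡0 → case k≡0 zero of λ ()) , refl)

lemma6 : (c : ℕ) → 3 ≤ c → c ≢ 6 →
    ((MultDep (2 ∷ 6 ∷ c ∷ []) × MultDep (3 ∷ 7 ∷ (c + 1) ∷ []) × MultDep (4 ∷ 8 ∷ (c + 2) ∷ []))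
    ⇔ (c ≡ 8 ⊎ c ≡ 48))
lemma6 c@(suc _) 3≤c c≢6 = mk⇔ solution (λ { (inj₁ refl) → MultDep-8 ; (inj₂ refl) → MultDep-48 })
  where
  solution : MultDep (2 ∷ 6 ∷ c ∷ []) × MultDep (3 ∷ 7 ∷ (c + 1) ∷ []) × MultDep (4 ∷ 8 ∷ (c + 2) ∷ []) →
             c ≡ 8 ⊎ c ≡ 48
  solution (dep₁ , dep₂ , _)
    with smooth-factorisation c (MultDep[2,6,c]⇒primes dep₁)
       | smooth-factorisation (c + 1) (MultDep[3,7,c]⇒primes dep₂)
  ... | u , v , c≡2^u3^v | s , t , c+1≡3^s7^t =
    smooth-consecutive u v s t c≡2^u3^v c+1≡3^s7^t 3≤c c≢6
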